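{- Let $K,L\subseteq \mathbb{Z}_{\ge 2}$. Suppose there exists a PBD$(v,K)$ of dimension $d$ and, for each $k\in K$, there exists a PBD$(k,L)$. Then there exists a PBD$(v,L)$ of dimension at least $d$.
   Context: A PBD$(v,K)$ is a pair $(X,\mathcal{B})$ with $|X|=v$, blocks $B\subseteq X$ with $|B|\in K$, such that any two distinct points lie in exactly one block. A subspace is a subset $X'\subseteq X$ such that every block containing at least two points of $X'$ is contained in $X'$; proper means $X'\ne X$. The subspace generated by $Y$ is the intersection of all subspaces containing $Y$. The dimension of a PBD is the maximum $d$ such that every set of $d$ points generates a proper subspace. -}

module Defs where

open import Data.Nat using (ℕ; _≤_)
open import Data.Fin using (Fin)
open import Data.Fin.Subset using (Subset; _∈_; _∉_; _⊆_; ∣_∣)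
open import Data.List using (List; length; lookup)
open import Data.Product using (Σ; ∃; _×_)
open import Relation.Binary.PropositionalEquality using (_≡_; _≢_)
open import Relation.Nullary using (¬_)

-- A pairwise balanced design PBD(v,K) on the point set X = Fin v.  Blocks are a finite list of subsets
-- of X, each of size in K; any two distinct points lie in exactly one
-- block ("exactly one" = a unique list position).
record PBD (v : ℕ) (K : ℕ → Set) : Set where
  field
    blocks   : List (Subset v)
    sizes    : (i : Fin (length blocks)) → K ∣ lookup blocks i ∣
    pairs    : (x y : Fin v) → x ≢ y →
               Σ (Fin (length blocks)) λ i →
                 (x ∈ lookup blocks i × y ∈ lookup blocks i) ×
                 ((j : Fin (length blocks)) →
                   x ∈ lookup blocks j → y ∈ lookup blocks j → j ≡ i)
open PBD public

IsSubspace : {v : ℕ} {K : ℕ → Set} → PBD v K → Subset v → Set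
IsSubspace {v} D S =
  (i : Fin (length (blocks D))) (x y : Fin v) → x ≢ y →
  x ∈ S → y ∈ S → x ∈ lookup (blocks D) i → y ∈ lookup (blocks D) i →
  lookup (blocks D) i ⊆ S

InGenerated : {v : ℕ} {K : ℕ → Set} → PBD v K → Subset v → Fin v → Set
InGenerated D Y x = (S : Subset _) → IsSubspace D S → Y ⊆ S → x ∈ S

GeneratesProper : {v : ℕ} {K : ℕ → Set} → PBD v K → Subset v → Set
GeneratesProper {v} D Y = ∃ λ (x : Fin v) → ¬ InGenerated D Y x

AllProper : {v : ℕ} {K : ℕ → Set} → PBD v K → ℕ → Set
AllProper {v} D d = (Y : Subset v) → ∣ Y ∣ ≡ d → GeneratesProper D Y

-- D has dimension d: d is the maximum (among d ≤ v, i.e. values for which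
-- d-point sets exist) such that every d-point set generates a proper subspace.
HasDimension : {v : ℕ} {K : ℕ → Set} → PBD v K → ℕ → Set
HasDimension {v} D d =
  d ≤ v × AllProper D d × ((d' : ℕ) → d' ≤ v → AllProper D d' → d' ≤ d)

-- Replace every block B of the PBD(v,K) by a copy of a PBD(|B|,L) placed on
-- the points of B. Two points of X still lie in exactly one block: the unique
-- old block B through them, then the unique new block inside B. Each new block
-- lies inside an old one, so every subspace of the old design is a subspace of
-- the new one; hence a set generating a proper subspace before still does, and
-- the new design's dimension, which exists because all notions involved are
-- decidable over finitely many points and subsets, is at least d.
module Submission where

open import Defs
open import Data.Nat using (ℕ; zero; suc; _≤_; z≤n)
import Data.Nat as ℕ using (_≟_)
open import Data.Nat.Properties using (≤-refl; ≤-pred; ≤∧≢⇒<; m≤n⇒m≤1+n)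
open import Data.Fin using (Fin; zero; suc)
open import Data.Fin.Properties using (all?; any?)
import Data.Fin.Properties as Fin
open import Data.Fin.Subset using (Subset; _∈_; _⊆_; ∣_∣; inside; outside)
open import Data.Fin.Subset.Properties using (_∈?_; _⊆?_; anySubset?)
open import Data.List using (List; []; _∷_; _++_; length; lookup; tabulate; concat)
open import Data.Product using (Σ; ∃; _×_; _,_; proj₁; uncurry)
open import Data.Sum using (_⊎_; inj₁; inj₂; [_,_]′)
open import Data.Vec using ([]; _∷_; _[_]=_)
open _[_]=_
open import Function using (_∘_)
open import Relation.Binary.PropositionalEquality
  using (_≡_; _≢_; refl; sym; trans; cong; subst)
open import Relation.Nullary using (Dec; yes; no; ¬_)
open import Relation.Nullary.Decidable using (¬?; _→-dec_; decidable-stable)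
open import Relation.Unary using (Decidable)

private
  variable
    v : ℕ

∀-Subset? : ∀ {P : Subset v → Set} → Decidable P → Dec ((S : Subset v) → P S)
∀-Subset? P? with anySubset? (¬? ∘ P?)
... | yes (S , ¬PS) = no λ ∀P → ¬PS (∀P S)
... | no ¬∃¬P       = yes λ S → decidable-stable (P? S) (λ ¬PS → ¬∃¬P (S , ¬PS))

module _ {K : ℕ → Set} (D : PBD v K) where

  IsSubspace? : Decidable (IsSubspace D)
  IsSubspace? S = all? λ i → all? λ x → all? λ y →
    ¬? (x Fin.≟ y) →-dec (x ∈? S →-dec (y ∈? S →-dec
      (x ∈? B i →-dec (y ∈? B i →-dec (B i ⊆? S)))))
    where B = lookup (blocks D)

  InGenerated? : (Y : Subset v) → Decidable (InGenerated D Y)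
  InGenerated? Y x = ∀-Subset? λ S → IsSubspace? S →-dec (Y ⊆? S →-dec x ∈? S)

  AllProper? : Decidable (AllProper D)
  AllProper? d = ∀-Subset? λ Y → ∣ Y ∣ ℕ.≟ d →-dec any? (¬? ∘ InGenerated? Y)

module _ {P : ℕ → Set} (P? : Decidable P) where

  private
    ≤-below : ∀ {n v} → ¬ P (suc v) → n ≤ suc v → P n → n ≤ v
    ≤-below ¬Pv n≤v Pn = ≤-pred (≤∧≢⇒< n≤v λ { refl → ¬Pv Pn })

  greatest-≤ : ∀ {d} v → P d → d ≤ v →
    ∃ λ m → d ≤ m × m ≤ v × P m × (∀ n → n ≤ v → P n → n ≤ m)
  greatest-≤ zero Pd z≤n = zero , z≤n , z≤n , Pd , λ _ n≤0 _ → n≤0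
  greatest-≤ (suc v) Pd d≤v with P? (suc v)
  ... | yes Pv = suc v , d≤v , ≤-refl , Pv , λ _ n≤v _ → n≤v
  ... | no ¬Pv with greatest-≤ v Pd (≤-below ¬Pv d≤v Pd)
  ...   | m , d≤m , m≤v , Pm , max =
    m , d≤m , m≤n⇒m≤1+n m≤v , Pm , λ n n≤v Pn → max n (≤-below ¬Pv n≤v Pn) Pn

dimension-≥ : ∀ {v K d} (D : PBD v K) → d ≤ v → AllProper D d →
  ∃ λ d′ → HasDimension D d′ × d ≤ d′
dimension-≥ {v} D d≤v Pd with greatest-≤ (AllProper? D) v Pd d≤v
... | d′ , d≤d′ , d′≤v , Pd′ , max = d′ , (d′≤v , Pd′ , max) , d≤d′

AllProper-subspace-mono : ∀ {K L d} (D : PBD v K) (D′ : PBD v L) →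
  (∀ S → IsSubspace D S → IsSubspace D′ S) → AllProper D d → AllProper D′ d
AllProper-subspace-mono D D′ sub proper Y ∣Y∣≡d with proper Y ∣Y∣≡d
... | x , x∉⟨Y⟩ = x , λ x∈⟨Y⟩′ → x∉⟨Y⟩ λ S S-sub Y⊆S → x∈⟨Y⟩′ S (sub S S-sub) Y⊆S

embed : (B : Subset v) → Fin ∣ B ∣ → Fin v
embed (inside  ∷ B) zero    = zero
embed (inside  ∷ B) (suc a) = suc (embed B a)
embed (outside ∷ B) a       = suc (embed B a)

embed-surjective : (B : Subset v) → ∀ {x} → x ∈ B → ∃ λ a → embed B a ≡ x
embed-surjective (inside  ∷ B) here = zero , refl
embed-surjective (inside  ∷ B) (there x∈B) with embed-surjective B x∈B
... | a , refl = suc a , refl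
embed-surjective (outside ∷ B) (there x∈B) with embed-surjective B x∈B
... | a , refl = a , refl

image : (B : Subset v) → Subset ∣ B ∣ → Subset v
image []            _       = []
image (inside  ∷ B) (t ∷ T) = t ∷ image B T
image (outside ∷ B) T       = outside ∷ image B T

∣image∣ : (B : Subset v) (T : Subset ∣ B ∣) → ∣ image B T ∣ ≡ ∣ T ∣
∣image∣ []            []            = refl
∣image∣ (inside  ∷ B) (inside  ∷ T) = cong suc (∣image∣ B T)
∣image∣ (inside  ∷ B) (outside ∷ T) = ∣image∣ B T
∣image∣ (outside ∷ B) T             = ∣image∣ B T

image⊆ : (B : Subset v) (T : Subset ∣ B ∣) → image B T ⊆ B
image⊆ (inside  ∷ B) (t ∷ T) here      = here
image⊆ (inside  ∷ B) (t ∷ T) (there x) = there (image⊆ B T x)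
image⊆ (outside ∷ B) T       (there x) = there (image⊆ B T x)

∈-image⁺ : (B : Subset v) (T : Subset ∣ B ∣) {a : Fin ∣ B ∣} → a ∈ T → embed B a ∈ image B T
∈-image⁺ (inside  ∷ B) (t ∷ T) here      = here
∈-image⁺ (inside  ∷ B) (t ∷ T) (there a) = there (∈-image⁺ B T a)
∈-image⁺ (outside ∷ B) T       a         = there (∈-image⁺ B T a)

∈-image⁻ : (B : Subset v) (T : Subset ∣ B ∣) (a : Fin ∣ B ∣) → embed B a ∈ image B T → a ∈ T
∈-image⁻ (inside  ∷ B) (t ∷ T) zero    here      = here
∈-image⁻ (inside  ∷ B) (t ∷ T) (suc a) (there x) = there (∈-image⁻ B T a x)
∈-image⁻ (outside ∷ B) T       a       (there x) = ∈-image⁻ B T a x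

module _ {A : Set} where

  ↑ˡ : (xs ys : List A) → Fin (length xs) → Fin (length (xs ++ ys))
  ↑ˡ (x ∷ xs) ys zero    = zero
  ↑ˡ (x ∷ xs) ys (suc p) = suc (↑ˡ xs ys p)

  ↑ʳ : (xs ys : List A) → Fin (length ys) → Fin (length (xs ++ ys))
  ↑ʳ []       ys p = p
  ↑ʳ (x ∷ xs) ys p = suc (↑ʳ xs ys p)

  split : (xs ys : List A) → Fin (length (xs ++ ys)) → Fin (length xs) ⊎ Fin (length ys)
  split []       ys p       = inj₂ p
  split (x ∷ xs) ys zero    = inj₁ zero
  split (x ∷ xs) ys (suc p) with split xs ys p
  ... | inj₁ q = inj₁ (suc q)
  ... | inj₂ q = inj₂ q

  join-split : (xs ys : List A) (p : Fin (length (xs ++ ys))) →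
    [ ↑ˡ xs ys , ↑ʳ xs ys ]′ (split xs ys p) ≡ p
  join-split []       ys p       = refl
  join-split (x ∷ xs) ys zero    = refl
  join-split (x ∷ xs) ys (suc p) with split xs ys p | join-split xs ys p
  ... | inj₁ q | eq = cong suc eq
  ... | inj₂ q | eq = cong suc eq

  lookup-↑ˡ : (xs ys : List A) (p : Fin (length xs)) → lookup (xs ++ ys) (↑ˡ xs ys p) ≡ lookup xs p
  lookup-↑ˡ (x ∷ xs) ys zero    = refl
  lookup-↑ˡ (x ∷ xs) ys (suc p) = lookup-↑ˡ xs ys p

  lookup-↑ʳ : (xs ys : List A) (p : Fin (length ys)) → lookup (xs ++ ys) (↑ʳ xs ys p) ≡ lookup ys p
  lookup-↑ʳ []       ys p = refl
  lookup-↑ʳ (x ∷ xs) ys p = lookup-↑ʳ xs ys p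

  -- f lists the entries of xs, possibly with repetitions: the positions of xs
  -- form a retract of I.
  record Listing {I : Set} (f : I → A) (xs : List A) : Set where
    field
      position        : I → Fin (length xs)
      index           : Fin (length xs) → I
      lookup-position : ∀ a → lookup xs (position a) ≡ f a
      position-index  : ∀ p → position (index p) ≡ p

    lookup-index : ∀ p → lookup xs p ≡ f (index p)
    lookup-index p = trans (cong (lookup xs) (sym (position-index p))) (lookup-position (index p))

  open Listing

  tabulate-listing : ∀ {n} (f : Fin n → A) → Listing f (tabulate f)
  tabulate-listing {zero} f = record
    { position = λ () ; index = λ () ; lookup-position = λ () ; position-index = λ () }
  tabulate-listing {suc n} f = record
    { position        = λ { zero → zero ; (suc a) → suc (position L a) }
    ; index           = λ { zero → zero ; (suc p) → suc (index L p) }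
    ; lookup-position = λ { zero → refl ; (suc a) → lookup-position L a }
    ; position-index  = λ { zero → refl ; (suc p) → cong suc (position-index L p) }
    }
    where L = tabulate-listing (f ∘ suc)

  ++-listing : ∀ {I J : Set} {f : I → A} {g : J → A} {xs ys : List A} →
    Listing f xs → Listing g ys → Listing [ f , g ]′ (xs ++ ys)
  ++-listing {xs = xs} {ys} L M = record
    { position        = [ ↑ˡ xs ys ∘ position L , ↑ʳ xs ys ∘ position M ]′
    ; index           = λ p → [ inj₁ ∘ index L , inj₂ ∘ index M ]′ (split xs ys p)
    ; lookup-position = λ { (inj₁ a) → trans (lookup-↑ˡ xs ys _) (lookup-position L a)
                          ; (inj₂ b) → trans (lookup-↑ʳ xs ys _) (lookup-position M b) }
    ; position-index  = λ p → trans (position-index-split (split xs ys p)) (join-split xs ys p)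
    }
    where
    position-index-split : ∀ s →
      [ ↑ˡ xs ys ∘ position L , ↑ʳ xs ys ∘ position M ]′ ([ inj₁ ∘ index L , inj₂ ∘ index M ]′ s)
        ≡ [ ↑ˡ xs ys , ↑ʳ xs ys ]′ s
    position-index-split (inj₁ p) = cong (↑ˡ xs ys) (position-index L p)
    position-index-split (inj₂ p) = cong (↑ʳ xs ys) (position-index M p)

  reindex-listing : ∀ {I J : Set} {f : I → A} {g : J → A} {xs : List A} (φ : J → I) (ψ : I → J) →
    (∀ a → φ (ψ a) ≡ a) → (∀ b → f (φ b) ≡ g b) → Listing f xs → Listing g xs
  reindex-listing φ ψ φψ fφ L = record
    { position        = position L ∘ φ
    ; index           = ψ ∘ index L
    ; lookup-position = λ b → trans (lookup-position L (φ b)) (fφ b)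
    ; position-index  = λ p → trans (cong (position L) (φψ (index L p))) (position-index L p)
    }

  concat-listing : ∀ {n} {I : Fin n → Set} {f : ∀ i → I i → A} {xss : Fin n → List A} →
    (∀ i → Listing (f i) (xss i)) → Listing (uncurry f) (concat (tabulate xss))
  concat-listing {zero} L = record
    { position = λ () ; index = λ () ; lookup-position = λ () ; position-index = λ () }
  concat-listing {suc n} {I} {f} L =
    reindex-listing φ ψ φψ fφ (++-listing (L zero) (concat-listing (L ∘ suc)))
    where
    φ : Σ (Fin (suc n)) I → I zero ⊎ Σ (Fin n) (I ∘ suc)
    φ (zero  , a) = inj₁ a
    φ (suc i , a) = inj₂ (i , a)
    ψ : I zero ⊎ Σ (Fin n) (I ∘ suc) → Σ (Fin (suc n)) I
    ψ (inj₁ a)       = zero , a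
    ψ (inj₂ (i , a)) = suc i , a
    φψ : ∀ a → φ (ψ a) ≡ a
    φψ (inj₁ a) = refl
    φψ (inj₂ a) = refl
    fφ : ∀ b → [ f zero , uncurry (f ∘ suc) ]′ (φ b) ≡ uncurry f b
    fφ (zero  , a) = refl
    fφ (suc i , a) = refl

module Refinement {K L : ℕ → Set} (D : PBD v K)
  (E : (i : Fin (length (blocks D))) → PBD ∣ lookup (blocks D) i ∣ L) where

  open Listing

  B : Fin (length (blocks D)) → Subset v
  B = lookup (blocks D)

  Index : Set
  Index = Σ (Fin (length (blocks D))) λ i → Fin (length (blocks (E i)))

  block : Index → Subset v
  block (i , t) = image (B i) (lookup (blocks (E i)) t)

  refinedBlocks : List (Subset v)
  refinedBlocks = concat (tabulate λ i → tabulate λ t → block (i , t))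

  refinedListing : Listing block refinedBlocks
  refinedListing = concat-listing λ i → tabulate-listing λ t → block (i , t)

  ∈-position : ∀ {x} j → x ∈ block j → x ∈ lookup refinedBlocks (position refinedListing j)
  ∈-position {x} j = subst (x ∈_) (sym (lookup-position refinedListing j))

  ∈-index : ∀ {x} p → x ∈ lookup refinedBlocks p → x ∈ block (index refinedListing p)
  ∈-index {x} p = subst (x ∈_) (lookup-index refinedListing p)

  refinedBlock⊆ : ∀ p → lookup refinedBlocks p ⊆ B (proj₁ (index refinedListing p))
  refinedBlock⊆ p = image⊆ _ _ ∘ ∈-index p

  refinedSizes : ∀ p → L ∣ lookup refinedBlocks p ∣
  refinedSizes p with index refinedListing p | lookup-index refinedListing p
  ... | i , t | eq = subst L (sym (trans (cong ∣_∣ eq) (∣image∣ (B i) _))) (sizes (E i) t)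

  refinedPairs : (x y : Fin v) → x ≢ y →
    Σ (Fin (length refinedBlocks)) λ p →
      (x ∈ lookup refinedBlocks p × y ∈ lookup refinedBlocks p) ×
      ((q : Fin (length refinedBlocks)) →
        x ∈ lookup refinedBlocks q → y ∈ lookup refinedBlocks q → q ≡ p)
  refinedPairs x y x≢y with pairs D x y x≢y
  ... | i , (x∈B , y∈B) , uniqueD with embed-surjective (B i) x∈B | embed-surjective (B i) y∈B
  ... | a , refl | b , refl with pairs (E i) a b (λ { refl → x≢y refl })
  ... | t , (a∈T , b∈T) , uniqueE =
    position refinedListing (i , t) ,
    (∈-position (i , t) (∈-image⁺ (B i) _ a∈T) , ∈-position (i , t) (∈-image⁺ (B i) _ b∈T)) ,
    λ q x∈q y∈q → trans (sym (position-index refinedListing q))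
      (cong (position refinedListing) (unique (index refinedListing q) (∈-index q x∈q) (∈-index q y∈q)))
    where
    unique : ∀ j → embed (B i) a ∈ block j → embed (B i) b ∈ block j → j ≡ (i , t)
    unique (i′ , t′) x∈j y∈j with uniqueD i′ (image⊆ (B i′) _ x∈j) (image⊆ (B i′) _ y∈j)
    ... | refl = cong (i ,_) (uniqueE t′ (∈-image⁻ (B i) _ a x∈j) (∈-image⁻ (B i) _ b y∈j))

  refined : PBD v L
  refined = record { blocks = refinedBlocks ; sizes = refinedSizes ; pairs = refinedPairs }

  subspace-refined : ∀ S → IsSubspace D S → IsSubspace refined S
  subspace-refined S S-sub p x y x≢y x∈S y∈S x∈p y∈p =
    S-sub (proj₁ (index refinedListing p)) x y x≢y x∈S y∈S
      (refinedBlock⊆ p x∈p) (refinedBlock⊆ p y∈p) ∘ refinedBlock⊆ p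

mainTheorem3 : (K L : ℕ → Set) →
    ((k : ℕ) → K k → 2 ≤ k) → ((l : ℕ) → L l → 2 ≤ l) →
    (v d : ℕ) → (D : PBD v K) → HasDimension D d →
    ((k : ℕ) → K k → PBD k L) →
    Σ (PBD v L) λ D' → ∃ λ d' → HasDimension D' d' × d ≤ d'
mainTheorem3 K L _ _ v d D (d≤v , proper , _) E =
  refined , dimension-≥ refined d≤v (AllProper-subspace-mono D refined subspace-refined proper)
  where open Refinement D (λ i → E _ (sizes D i))
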